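{- Let $P$ and $Q$ be dMTSs over a common alphabet $A$, and let $p\in P$, $q\in Q$. (i) There exist a dMTS $R$ over $A$ and a state $r\in R$ with $r\sqsubseteq_{\mathrm{dMTS}} p$ and $r\sqsubseteq_{\mathrm{dMTS}} q$ if and only if $p\wedge q$ is defined. (ii) If $p\wedge q$ is defined, then for every dMTS $R$ over $A$ and every $r\in R$: $r\sqsubseteq_{\mathrm{dMTS}} p$ and $r\sqsubseteq_{\mathrm{dMTS}} q$ if and only if $r\sqsubseteq_{\mathrm{dMTS}} p\wedge q$.
   Context: A disjunctive Modal Transition System (dMTS) is a tuple $(P,A,\longrightarrow_P,\dashrightarrow_P)$ with $P$ a set of states, $A$ an alphabet not containing the silent action $\tau$, a must-transition relation $\longrightarrow_P\subseteq P\times A\times(2^P\setminus\{\emptyset\})$ and a may-transition relation $\dashrightarrow_P\subseteq P\times(A\cup\{\tau\})\times P$, satisfying syntactic consistency: $p\xrightarrow{a}P'$ (must) implies $p\stackrel{a}{\dashrightarrow}p'$ (may) for all $p'\in P'$. Write $p\xrightarrow{a}$ if $p\xrightarrow{a}P'$ for some $P'$. Weak may-transitions: $p\stackrel{\epsilon}{\Longrightarrow}p'$ iff $p(\stackrel{\tau}{\dashrightarrow})^*p'$; for $\alpha\in A\cup\{\tau\}$, $p\stackrel{\alpha}{\Longrightarrow}p'$ iff there is $p''$ with $p\stackrel{\epsilon}{\Longrightarrow}p''\stackrel{\alpha}{\dashrightarrow}p'$ (so for $\alpha=\tau$ at least one step); $p\stackrel{\alpha}{\Longrightarrow}$ means such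 $p'$ exists, and $\not\stackrel{\alpha}{\Longrightarrow}$ its negation. $\hat\alpha=\epsilon$ if $\alpha=\tau$, else $\hat\alpha=\alpha$. For dMTSs $P,Q$ over $A$, $\mathcal R\subseteq P\times Q$ is an observational modal refinement relation if for all $(p,q)\in\mathcal R$: (i) $q\xrightarrow{a}Q'$ implies there is $P'$ with $p\xrightarrow{a}P'$ and for every $p'\in P'$ some $q'\in Q'$ with $(p',q')\in\mathcal R$; (ii) $p\stackrel{\alpha}{\dashrightarrow}p'$ implies there is $q'$ with $q\stackrel{\hat\alpha}{\Longrightarrow}q'$ and $(p',q')\in\mathcal R$. $p\sqsubseteq_{\mathrm{dMTS}}q$ iff some such relation contains $(p,q)$. Conjunctive product $P\& Q$ of dMTSs $P,Q$ over $A$: state set $P\times Q$, alphabet $A$, with (Must1) $(p,q)\xrightarrow{a}\{(p',q'): p'\in P', q\stackrel{a}{\Longrightarrow}_Qq'\}$ if $p\xrightarrow{a}_PP'$ and $q\stackrel{a}{\Longrightarrow}_Q$; (Must2) $(p,q)\xrightarrow{a}\{(p',q'): p\stackrel{a}{\Longrightarrow}_Pp', q'\in Q'\}$ if $p\stackrel{a}{\Longrightarrow}_P$ and $q\xrightarrow{a}_QQ'$; (May1) $(p,q)\stackrel{\tau}{\dashrightarrow}(p',q)$ if $p\stackrel{\tau}{\Longrightarrow}_Pp'$; (May2) $(p,q)\stackrel{\tau}{\dashrightarrow}(p,q')$ if $q\stackrel{\tau}{\Longrightarrow}_Qq'$; (May3) $(p,q)\stackrel{\alpha}{\dashrightarrow}(p',q')$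 if $p\stackrel{\alpha}{\Longrightarrow}_Pp'$ and $q\stackrel{\alpha}{\Longrightarrow}_Qq'$ ($\alpha\in A\cup\{\tau\}$). The set $F\subseteq P\times Q$ of inconsistent states is the least set with: (F1) $p\xrightarrow{a}_P$ and $q\not\stackrel{a}{\Longrightarrow}_Q$ imply $(p,q)\in F$; (F2) $p\not\stackrel{a}{\Longrightarrow}_P$ and $q\xrightarrow{a}_Q$ imply $(p,q)\in F$; (F3) $(p,q)\xrightarrow{a}R'$ in $P\& Q$ with $R'\subseteq F$ implies $(p,q)\in F$. The conjunction $P\wedge Q$ is obtained from $P\& Q$ by deleting all states in $F$, all may- and must-transitions leaving deleted states, all may-transitions entering deleted states, and deleting deleted states from targets of must-transitions. The state $(p,q)$ of $P\wedge Q$ is written $p\wedge q$; $p\wedge q$ is defined iff $(p,q)\notin F$. -}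

module Defs where

open import Level using (Level)
open import Data.Product using (Σ; ∃; _×_; _,_; proj₁; proj₂)
open import Relation.Nullary using (¬_)
open import Relation.Binary.Construct.Closure.ReflexiveTransitive using (Star)

data Act (A : Set) : Set where
  τ   : Act A
  act : A → Act A

-- Must-transitions are represented as indexed objects: every  m : Must p a
-- is a must-transition  p --a--> target m  (target m : a subset of the states).
record PreDMTS (A : Set) : Set₁ where
  field
    State  : Set
    Must   : State → A → Set
    target : ∀ {p a} → Must p a → State → Set
    May    : State → Act A → State → Set

record DMTS (A : Set) : Set₁ where
  field
    pre : PreDMTS A
  open PreDMTS pre public
  field
    nonempty   : ∀ {p a} (m : Must p a) → ∃ (target m)
    consistent : ∀ {p a} (m : Must p a) {p'} → target m p' → May p (act a) p'

module Weak {A : Set} (T : PreDMTS A) where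
  open PreDMTS T

  τ-step : State → State → Set
  τ-step p p' = May p τ p'

  _⇒ε_ : State → State → Set
  _⇒ε_ = Star τ-step

  -- p =α=> p'  (for α = τ at least one τ-step)
  _⇒[_]_ : State → Act A → State → Set
  p ⇒[ α ] p' = ∃ λ p'' → (p ⇒ε p'') × May p'' α p'

  _⇒[_] : State → Act A → Set
  p ⇒[ α ] = ∃ λ p' → p ⇒[ α ] p'

  _⇒^[_]_ : State → Act A → State → Set
  p ⇒^[ τ ] p' = p ⇒ε p'
  p ⇒^[ act a ] p' = p ⇒[ act a ] p'

IsRefinement : {A : Set} (P Q : PreDMTS A) →
               (PreDMTS.State P → PreDMTS.State Q → Set) → Set
IsRefinement P Q ℛ =
  ∀ {p q} → ℛ p q →
    (∀ {a} (n : Q.Must q a) →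
       Σ (P.Must p a) λ m → ∀ {p'} → P.target m p' →
         ∃ λ q' → Q.target n q' × ℛ p' q')
    × (∀ {α p'} → P.May p α p' → ∃ λ q' → (q WQ.⇒^[ α ] q') × ℛ p' q')
  where
    module P = PreDMTS P
    module Q = PreDMTS Q
    module WQ = Weak Q

Refines : {A : Set} (P Q : PreDMTS A) → PreDMTS.State P → PreDMTS.State Q → Set₁
Refines P Q p q =
  Σ (PreDMTS.State P → PreDMTS.State Q → Set) λ ℛ → IsRefinement P Q ℛ × ℛ p q

module Conj {A : Set} (P Q : PreDMTS A) where
  private
    module P = PreDMTS P
    module Q = PreDMTS Q
    module WP = Weak P
    module WQ = Weak Q

  PQ : Set
  PQ = P.State × Q.State

  data ProdMust : PQ → A → Set where
    must1 : ∀ {p q a} → P.Must p a → q WQ.⇒[ act a ] → ProdMust (p , q) a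
    must2 : ∀ {p q a} → p WP.⇒[ act a ] → Q.Must q a → ProdMust (p , q) a

  prodTarget : ∀ {s a} → ProdMust s a → PQ → Set
  prodTarget {(p , q)} {a} (must1 m _) (p' , q') = P.target m p' × (q WQ.⇒[ act a ] q')
  prodTarget {(p , q)} {a} (must2 _ n) (p' , q') = (p WP.⇒[ act a ] p') × Q.target n q'

  data ProdMay : PQ → Act A → PQ → Set where
    may1 : ∀ {p q p'} → p WP.⇒[ τ ] p' → ProdMay (p , q) τ (p' , q)
    may2 : ∀ {p q q'} → q WQ.⇒[ τ ] q' → ProdMay (p , q) τ (p , q')
    may3 : ∀ {p q p' q' α} → p WP.⇒[ α ] p' → q WQ.⇒[ α ] q' → ProdMay (p , q) α (p' , q')

  _&_ : PreDMTS A
  _&_ = record { State = PQ ; Must = ProdMust ; target = prodTarget ; May = ProdMay }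

  data Inconsistent : PQ → Set where
    F1 : ∀ {p q a} → P.Must p a → ¬ (q WQ.⇒[ act a ]) → Inconsistent (p , q)
    F2 : ∀ {p q a} → ¬ (p WP.⇒[ act a ]) → Q.Must q a → Inconsistent (p , q)
    F3 : ∀ {s a} (m : ProdMust s a) → (∀ {s'} → prodTarget m s' → Inconsistent s') →
         Inconsistent s

  Defined : P.State → Q.State → Set
  Defined p q = ¬ Inconsistent (p , q)

  -- P ∧ Q : delete the states in F (and all transitions from/to them,
  -- and deleted states from must-targets)
  ConjState : Set
  ConjState = Σ PQ λ s → ¬ Inconsistent s

  _∧_ : PreDMTS A
  _∧_ = record
    { State  = ConjState
    ; Must   = λ s a → ProdMust (proj₁ s) a
    ; target = λ m s' → prodTarget m (proj₁ s')
    ; May    = λ s α s' → ProdMay (proj₁ s) α (proj₁ s')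
    }

  conjState : (p : P.State) (q : Q.State) → Defined p q → ConjState
  conjState p q d = (p , q) , d

-- If r refines both p and q, each must-transition of p (or q) is matched by
-- one of r, and a state in its nonempty target gives, via syntactic
-- consistency, a weak move of the other side.  So a common refinement never
-- meets F1 or F2, and by induction on F never F3: p ∧ q is defined, and the
-- pairs of related states form a refinement r ⊑ p ∧ q.  Conversely the
-- projections are refinements p ∧ q ⊑ p and p ∧ q ⊑ q (excluded middle
-- extracts the weak moves needed by Must1/Must2 from consistency of p ∧ q),
-- so by transitivity every refinement of p ∧ q refines p and q; and p ∧ q
-- itself, a dMTS once excluded middle makes its must-targets nonempty, is a
-- common refinement whenever it is defined.
module Submission where

open import Defs
open import Level using (0ℓ)
open import Data.Product using (Σ; ∃; _×_; _,_; proj₁; proj₂)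
open import Function.Bundles using (_⇔_; mk⇔)
open import Axiom.ExcludedMiddle using (ExcludedMiddle)
open import Axiom.DoubleNegationElimination using (DoubleNegationElimination; em⇒dne)
open import Relation.Binary.Construct.Closure.ReflexiveTransitive using (ε; _◅_; _◅◅_)
open import Relation.Binary.Construct.Composition using (_;_)
open import Relation.Binary.PropositionalEquality using (_≡_; refl)
open import Relation.Nullary using (¬_)

module WeakProperties {A : Set} (T : PreDMTS A) where
  open PreDMTS T
  open Weak T

  ◅-⇒τ : ∀ {x y z} → τ-step x y → y ⇒ε z → x ⇒[ τ ] z
  ◅-⇒τ {x} s ε = x , ε , s
  ◅-⇒τ s (s' ◅ w) = let (x' , w' , s'') = ◅-⇒τ s' w in x' , s ◅ w' , s''

  ε◅⇒ : ∀ {x y z α} → x ⇒ε y → y ⇒[ α ] z → x ⇒[ α ] z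
  ε◅⇒ w (y' , w' , s) = y' , w ◅◅ w' , s

  may⇒weak : ∀ {x y α} → May x α y → x ⇒[ α ] y
  may⇒weak {x} s = x , ε , s

  ⇒⇒⇒^ : ∀ {x y α} → x ⇒[ α ] y → x ⇒^[ α ] y
  ⇒⇒⇒^ {α = τ}     (x' , w , s) = w ◅◅ (s ◅ ε)
  ⇒⇒⇒^ {α = act a} w            = w

module _ {A : Set} {R S : PreDMTS A} {ℛ : PreDMTS.State R → PreDMTS.State S → Set}
         (ref : IsRefinement R S ℛ) where
  private
    module WR = Weak R
    module WS = Weak S
    open WeakProperties S

  simulate-⇒ε : ∀ {r r' s} → ℛ r s → r WR.⇒ε r' → ∃ λ s' → s WS.⇒ε s' × ℛ r' s'
  simulate-⇒ε {s = s} h ε = s , ε , h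
  simulate-⇒ε h (step ◅ w) =
    let (s' , w₁ , h')  = proj₂ (ref h) step
        (s'' , w₂ , h'') = simulate-⇒ε h' w
    in s'' , w₁ ◅◅ w₂ , h''

  simulate-⇒^ : ∀ {r r' s α} → ℛ r s → r WR.⇒^[ α ] r' → ∃ λ s' → s WS.⇒^[ α ] s' × ℛ r' s'
  simulate-⇒^ {α = τ}     h w = simulate-⇒ε h w
  simulate-⇒^ {α = act a} h (r'' , w , step) =
    let (s'' , w₁ , h'') = simulate-⇒ε h w
        (s' , w₂ , h')   = proj₂ (ref h'') step
    in s' , ε◅⇒ w₁ w₂ , h'

IsRefinement-trans : ∀ {A} {R S T : PreDMTS A}
  {ℛ : PreDMTS.State R → PreDMTS.State S → Set} {𝒮 : PreDMTS.State S → PreDMTS.State T → Set} →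
  IsRefinement R S ℛ → IsRefinement S T 𝒮 → IsRefinement R T (ℛ ; 𝒮)
IsRefinement-trans ref₁ ref₂ (s , h₁ , h₂) =
  (λ n → let (m₂ , f₂) = proj₁ (ref₂ h₂) n
             (m₁ , f₁) = proj₁ (ref₁ h₁) m₂
         in m₁ , λ t → let (s' , t₁ , h₁') = f₁ t
                           (t' , t₂ , h₂') = f₂ t₁
                       in t' , t₂ , s' , h₁' , h₂') ,
  (λ step → let (s' , w₁ , h₁') = proj₂ (ref₁ h₁) step
                (t' , w₂ , h₂') = simulate-⇒^ ref₂ h₂ w₁
            in t' , w₂ , s' , h₁' , h₂')

Refines-trans : ∀ {A} {R S T : PreDMTS A} {r s t} →
  Refines R S r s → Refines S T s t → Refines R T r t
Refines-trans (ℛ , ref₁ , h₁) (𝒮 , ref₂ , h₂) = ℛ ; 𝒮 , IsRefinement-trans ref₁ ref₂ , _ , h₁ , h₂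

module _ {A : Set} {R : DMTS A} {S : PreDMTS A} where
  open Weak S

  refinement-must-enabled : {ℛ : DMTS.State R → PreDMTS.State S → Set} →
    IsRefinement (DMTS.pre R) S ℛ → ∀ {r s a} → ℛ r s → DMTS.Must R r a → s ⇒[ act a ]
  refinement-must-enabled ref h m =
    let (_ , t)      = DMTS.nonempty R m
        (s' , w , _) = proj₂ (ref h) (DMTS.consistent R m t)
    in s' , w

module ConjunctionProperties {A : Set} (P Q : DMTS A) where
  private
    module P = DMTS P
    module Q = DMTS Q
    module WP = Weak P.pre
    module WQ = Weak Q.pre
    module WPP = WeakProperties P.pre
    module WPQ = WeakProperties Q.pre
  open Conj P.pre Q.pre
  open Weak _∧_ using () renaming (_⇒ε_ to _⇒ε∧_; _⇒^[_]_ to _⇒^∧[_]_)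

  &-may₁ : ∀ {p q p' q' α} → ProdMay (p , q) α (p' , q') → p WP.⇒^[ α ] p'
  &-may₁ (may1 w)   = WPP.⇒⇒⇒^ w
  &-may₁ (may2 _)   = ε
  &-may₁ (may3 w _) = WPP.⇒⇒⇒^ w

  &-may₂ : ∀ {p q p' q' α} → ProdMay (p , q) α (p' , q') → q WQ.⇒^[ α ] q'
  &-may₂ (may1 _)   = ε
  &-may₂ (may2 w)   = WPQ.⇒⇒⇒^ w
  &-may₂ (may3 _ w) = WPQ.⇒⇒⇒^ w

  ∧-⇒ε : ∀ {p q p' q'} {d : Defined p q} (d' : Defined p' q') →
    p WP.⇒ε p' → q WQ.⇒ε q' → ((p , q) , d) ⇒ε∧ ((p' , q') , d')
  ∧-⇒ε d' ε        ε        = ε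
  ∧-⇒ε d' ε        (s ◅ w)  = may2 (WPQ.◅-⇒τ s w) ◅ ε
  ∧-⇒ε d' (s ◅ w)  ε        = may1 (WPP.◅-⇒τ s w) ◅ ε
  ∧-⇒ε d' (s ◅ w) (s' ◅ w') = may3 (WPP.◅-⇒τ s w) (WPQ.◅-⇒τ s' w') ◅ ε

  ∧-⇒^ : ∀ {p q p' q' α} {d : Defined p q} (d' : Defined p' q') →
    p WP.⇒^[ α ] p' → q WQ.⇒^[ α ] q' → ((p , q) , d) ⇒^∧[ α ] ((p' , q') , d')
  ∧-⇒^ {α = τ}     d' wp wq = ∧-⇒ε d' wp wq
  ∧-⇒^ {α = act a} d' wp wq = _ , ε , may3 wp wq

  ∧-consistent : ∀ {s : ConjState} {a} (m : ProdMust (proj₁ s) a) {s' : ConjState} →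
    prodTarget m (proj₁ s') → ProdMay (proj₁ s) (act a) (proj₁ s')
  ∧-consistent (must1 m w) (t , w') = may3 (WPP.may⇒weak (P.consistent m t)) w'
  ∧-consistent (must2 w n) (w' , t) = may3 w' (WPQ.may⇒weak (Q.consistent n t))

  module CommonRefinement {R : DMTS A}
    {ℛ₁ : DMTS.State R → P.State → Set} (ref₁ : IsRefinement (DMTS.pre R) P.pre ℛ₁)
    {ℛ₂ : DMTS.State R → Q.State → Set} (ref₂ : IsRefinement (DMTS.pre R) Q.pre ℛ₂) where
    private
      module R = DMTS R

    Paired : R.State → PQ → Set
    Paired r (p , q) = ℛ₁ r p × ℛ₂ r q

    -- The component of the target not constrained by the must-transition is
    -- reached through the may-transition that syntactic consistency of R provides.
    paired-must : ∀ {r s a} → Paired r s → (n : ProdMust s a) →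
      Σ (R.Must r a) λ m → ∀ {r'} → R.target m r' → ∃ λ s' → prodTarget n s' × Paired r' s'
    paired-must (h₁ , h₂) (must1 n _) =
      let (m , f) = proj₁ (ref₁ h₁) n
      in m , λ t → let (p' , t' , h₁') = f t
                       (q' , w , h₂')  = proj₂ (ref₂ h₂) (R.consistent m t)
                   in (p' , q') , (t' , w) , h₁' , h₂'
    paired-must (h₁ , h₂) (must2 _ n) =
      let (m , f) = proj₁ (ref₂ h₂) n
      in m , λ t → let (q' , t' , h₂') = f t
                       (p' , w , h₁')  = proj₂ (ref₁ h₁) (R.consistent m t)
                   in (p' , q') , (w , t') , h₁' , h₂'

    paired-consistent : ∀ {r s} → Paired r s → ¬ Inconsistent s
    paired-consistent (h₁ , h₂) (F1 n ¬w) =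
      ¬w (refinement-must-enabled {R = R} ref₂ h₂ (proj₁ (proj₁ (ref₁ h₁) n)))
    paired-consistent (h₁ , h₂) (F2 ¬w n) =
      ¬w (refinement-must-enabled {R = R} ref₁ h₁ (proj₁ (proj₁ (ref₂ h₂) n)))
    paired-consistent h (F3 n all-inconsistent) =
      let (m , f)        = paired-must h n
          (_ , t)        = R.nonempty m
          (s' , t' , h') = f t
      in paired-consistent h' (all-inconsistent t')

    Paired∧ : R.State → ConjState → Set
    Paired∧ r s = Paired r (proj₁ s)

    paired-refines-∧ : IsRefinement R.pre _∧_ Paired∧
    paired-refines-∧ h =
      (λ n → let (m , f) = paired-must h n
             in m , λ t → let (s' , t' , h') = f t
                          in (s' , paired-consistent h') , t' , h') ,
      (λ step → let (p' , wp , h₁') = proj₂ (ref₁ (proj₁ h)) step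
                    (q' , wq , h₂') = proj₂ (ref₂ (proj₂ h)) step
                    d' = paired-consistent (h₁' , h₂')
                in ((p' , q') , d') , ∧-⇒^ d' wp wq , h₁' , h₂')

  common-refinement-defined : ∀ {R : DMTS A} {r p q} →
    Refines (DMTS.pre R) P.pre r p → Refines (DMTS.pre R) Q.pre r q → Defined p q
  common-refinement-defined {R} (_ , ref₁ , h₁) (_ , ref₂ , h₂) =
    CommonRefinement.paired-consistent {R} ref₁ ref₂ (h₁ , h₂)

  common-refinement-refines-∧ : ∀ {R : DMTS A} {r p q} (d : Defined p q) →
    Refines (DMTS.pre R) P.pre r p → Refines (DMTS.pre R) Q.pre r q →
    Refines (DMTS.pre R) _∧_ r (conjState p q d)
  common-refinement-refines-∧ {R} d (_ , ref₁ , h₁) (_ , ref₂ , h₂) =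
    _ , CommonRefinement.paired-refines-∧ {R} ref₁ ref₂ , h₁ , h₂

  Projects₁ : ConjState → P.State → Set
  Projects₁ s p = proj₁ (proj₁ s) ≡ p

  Projects₂ : ConjState → Q.State → Set
  Projects₂ s q = proj₂ (proj₁ s) ≡ q

  module _ (dne : DoubleNegationElimination 0ℓ) where

    ∧-nonempty : ∀ {s : ConjState} {a} (m : ProdMust (proj₁ s) a) →
      ∃ λ (s' : ConjState) → prodTarget m (proj₁ s')
    ∧-nonempty {s} m = dne λ no-target →
      proj₂ s (F3 m λ {s'} t → dne λ s'-consistent → no-target ((s' , s'-consistent) , t))

    ∧-dMTS : DMTS A
    ∧-dMTS = record
      { pre        = _∧_
      ; nonempty   = λ {s} → ∧-nonempty {s}
      ; consistent = λ {s} m {s'} → ∧-consistent {s} m {s'}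
      }

    Projects₁-isRefinement : IsRefinement _∧_ P.pre Projects₁
    Projects₁-isRefinement {_ , d} refl =
      (λ n → let w = dne λ ¬w → d (F1 n ¬w)
             in must1 n w , λ {s'} (t , _) → proj₁ (proj₁ s') , t , refl) ,
      (λ step → _ , &-may₁ step , refl)

    Projects₂-isRefinement : IsRefinement _∧_ Q.pre Projects₂
    Projects₂-isRefinement {_ , d} refl =
      (λ n → let w = dne λ ¬w → d (F2 ¬w n)
             in must2 w n , λ {s'} (_ , t) → proj₂ (proj₁ s') , t , refl) ,
      (λ step → _ , &-may₂ step , refl)

    ∧-refines-left : ∀ {p q} (d : Defined p q) → Refines _∧_ P.pre (conjState p q d) p
    ∧-refines-left d = Projects₁ , (λ {s} → Projects₁-isRefinement {s}) , refl

    ∧-refines-right : ∀ {p q} (d : Defined p q) → Refines _∧_ Q.pre (conjState p q d) q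
    ∧-refines-right d = Projects₂ , (λ {s} → Projects₂-isRefinement {s}) , refl

    refinement-of-∧-refines-both : ∀ {R : DMTS A} {r p q} (d : Defined p q) →
      Refines (DMTS.pre R) _∧_ r (conjState p q d) →
      Refines (DMTS.pre R) P.pre r p × Refines (DMTS.pre R) Q.pre r q
    refinement-of-∧-refines-both d r⊑p∧q =
      Refines-trans r⊑p∧q (∧-refines-left d) , Refines-trans r⊑p∧q (∧-refines-right d)

theorem3p5 : (∀ {ℓ} → ExcludedMiddle ℓ) →
    {A : Set} (P Q : DMTS A) (p : DMTS.State P) (q : DMTS.State Q) →
      ((Σ (DMTS A) λ R → Σ (DMTS.State R) λ r →
          Refines (DMTS.pre R) (DMTS.pre P) r p × Refines (DMTS.pre R) (DMTS.pre Q) r q)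
        ⇔ Conj.Defined (DMTS.pre P) (DMTS.pre Q) p q)
      × ((d : Conj.Defined (DMTS.pre P) (DMTS.pre Q) p q) →
          (R : DMTS A) (r : DMTS.State R) →
            (Refines (DMTS.pre R) (DMTS.pre P) r p × Refines (DMTS.pre R) (DMTS.pre Q) r q)
            ⇔ Refines (DMTS.pre R) (Conj._∧_ (DMTS.pre P) (DMTS.pre Q)) r
                (Conj.conjState (DMTS.pre P) (DMTS.pre Q) p q d))
theorem3p5 em P Q p q =
  mk⇔ (λ (R , r , r⊑p , r⊑q) → common-refinement-defined {R} r⊑p r⊑q)
      (λ d → ∧-dMTS dne , conjState p q d ,
             ∧-refines-left dne d , ∧-refines-right dne d) ,
  λ d R r → mk⇔ (λ (r⊑p , r⊑q) → common-refinement-refines-∧ {R} d r⊑p r⊑q)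
                (refinement-of-∧-refines-both dne {R} d)
  where
    open ConjunctionProperties P Q
    open Conj (DMTS.pre P) (DMTS.pre Q) using (conjState)
    dne : DoubleNegationElimination 0ℓ
    dne = em⇒dne em
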